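{- Let $r(x_1,\ldots,x_n)$ be a relation formula whose variables $x_1,\ldots,x_n$ are pairwise distinct, and let $y_1,\ldots,y_n$ be any variables. Then the formulas $r(x_1/y_1,\ldots,x_n/y_n)$ and $r(y_1,\ldots,y_n)$ are semantically equivalent.
   Context: Language: finite set $\mathcal R$ of relation symbols with arities $\delta(r)$; finite set $\mathcal X$ of variables, assumed to contain enough variables for the fresh choices below. Formulas: $1$; $r(x_1,\ldots,x_n)$; $(x\approx y)$; $\neg\varphi$; $\varphi\wedge\psi$; $\varphi\vee\psi$; $(\exists x)\varphi$. A structure $M$: nonempty finite set $M$ with $r^M\subseteq M^{\delta(r)}$. $\mathcal V=M^{\mathcal X}$, $\overline V=\mathcal V\setminus V$, $\mathrm C_x(V)=\{v:\exists u\in V,\ u(y)=v(y)\ \forall y\neq x\}$, $\mathrm D_{xy}=\{v:v(x)=v(y)\}$. Value: $\|1\|=\mathcal V$, $\|r(x_1,\ldots,x_n)\|=\{v:(v(x_1),\ldots,v(x_n))\in r^M\}$, $\|x\approx y\|=\mathrm D_{xy}$, $\|\neg\varphi\|=\overline{\|\varphi\|}$, $\wedge\mapsto\cap$, $\vee\mapsto\cup$, $\|(\exists x)\varphi\|=\mathrm C_x(\|\varphi\|)$. Formulas are semantically equivalent if they have equal values in every structure. Notation: $(\varphi)[x/y]$ denotes $(\exists x)(\varphi\wedge(x\approx y))$; $(\varphi)[x_1/y_1,\ldots,x_n/y_n]$ denotes $(\cdots((\varphi)[x_1/y_1])\cdots)[x_n/y_n]$; and $r(x_1/y_1,\ldots,x_n/y_n)$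 denotes $(r(x_1,\ldots,x_n))[x_1/z_1,\ldots,x_n/z_n,z_1/y_1,\ldots,z_n/y_n]$ where $z_1,\ldots,z_n$ are pairwise distinct variables none of which lies in $\{x_1,\ldots,x_n,y_1,\ldots,y_n\}$. -}

module Defs where

open import Data.Nat using (ℕ; suc)
open import Data.Fin using (Fin)
open import Data.Vec using (Vec; lookup; zip; toList)
open import Data.List using (List; []; _∷_; _++_)
open import Data.Product using (Σ; _×_; _,_; ∃)
open import Data.Sum using (_⊎_)
open import Data.Unit using (⊤)
open import Relation.Nullary using (¬_)
open import Relation.Binary.PropositionalEquality using (_≡_; _≢_)

module Language (nr : ℕ) (δ : Fin nr → ℕ) (nv : ℕ) where

  Var : Set
  Var = Fin nv

  data Formula : Set where
    𝟙    : Formula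
    rel  : (r : Fin nr) → Vec Var (δ r) → Formula
    _≈ᶠ_ : Var → Var → Formula
    ¬ᶠ_  : Formula → Formula
    _∧ᶠ_ : Formula → Formula → Formula
    _∨ᶠ_ : Formula → Formula → Formula
    ∃ᶠ   : Var → Formula → Formula

  -- A structure: a nonempty finite carrier (taken to be Fin (suc m)), and
  -- for each relation symbol r a relation r^M ⊆ M^δ(r) (given as a predicate).
  record Structure : Set₁ where
    field
      m     : ℕ
      interp : (r : Fin nr) → Vec (Fin (suc m)) (δ r) → Set

  open Structure

  Carrier : Structure → Set
  Carrier M = Fin (suc (m M))

  Assignment : Structure → Set
  Assignment M = Var → Carrier M

  Subset : Structure → Set₁
  Subset M = Assignment M → Set

  C : (M : Structure) → Var → Subset M → Subset M
  C M x V v = Σ (Assignment M) λ u → V u × (∀ y → y ≢ x → u y ≡ v y)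

  D : (M : Structure) → Var → Var → Subset M
  D M x y v = v x ≡ v y

  ⟦_⟧ : Formula → (M : Structure) → Subset M
  ⟦ 𝟙 ⟧ M v = ⊤
  ⟦ rel r xs ⟧ M v = interp M r (Data.Vec.map v xs)
  ⟦ x ≈ᶠ y ⟧ M v = D M x y v
  ⟦ ¬ᶠ φ ⟧ M v = ¬ (⟦ φ ⟧ M v)
  ⟦ φ ∧ᶠ ψ ⟧ M v = ⟦ φ ⟧ M v × ⟦ ψ ⟧ M v
  ⟦ φ ∨ᶠ ψ ⟧ M v = ⟦ φ ⟧ M v ⊎ ⟦ ψ ⟧ M v
  ⟦ ∃ᶠ x φ ⟧ M v = C M x (⟦ φ ⟧ M) v

  SemEquiv : Formula → Formula → Set₁
  SemEquiv φ ψ = ∀ (M : Structure) (v : Assignment M) →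
    (⟦ φ ⟧ M v → ⟦ ψ ⟧ M v) × (⟦ ψ ⟧ M v → ⟦ φ ⟧ M v)

  _[_/_] : Formula → Var → Var → Formula
  φ [ x / y ] = ∃ᶠ x (φ ∧ᶠ (x ≈ᶠ y))

  substs : Formula → List (Var × Var) → Formula
  substs φ [] = φ
  substs φ ((x , y) ∷ ps) = substs (φ [ x / y ]) ps

  -- r(x₁/y₁,…,xₙ/yₙ) with auxiliary variables z₁,…,zₙ:
  -- (r(x₁,…,xₙ))[x₁/z₁,…,xₙ/zₙ,z₁/y₁,…,zₙ/yₙ]
  relSubst : (r : Fin nr) (xs ys zs : Vec Var (δ r)) → Formula
  relSubst r xs ys zs = substs (rel r xs) (toList (zip xs zs) ++ toList (zip zs ys))

  PairwiseDistinct : ∀ {n} → Vec Var n → Set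
  PairwiseDistinct {n} xs = ∀ (i j : Fin n) → lookup xs i ≡ lookup xs j → i ≡ j

  Avoids : ∀ {n k} → Vec Var n → Vec Var k → Set
  Avoids {n} {k} zs ws = ∀ (i : Fin n) (j : Fin k) → lookup zs i ≢ lookup ws j

-- Under an assignment v, the formula φ [ x / y ] (with x ≢ y) holds exactly when φ holds
-- after overwriting the value of x by that of y.  Hence an iterated substitution acts on
-- assignments by a sequence of such overwrites, applied from the last pair to the first.
-- The pairs zᵢ/yᵢ come last in the formula, so they act first and store v (yᵢ) at zᵢ;
-- the pairs xᵢ/zᵢ then copy it to xᵢ.  Freshness of the zᵢ makes sure no overwrite
-- clobbers a value still to be read, and distinctness of the xᵢ (resp. zᵢ) makes sure
-- no later overwrite undoes an earlier one.
module Submission where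

open import Defs
open import Data.Nat using (ℕ)
open import Data.Fin using (Fin; zero; suc; _≟_)
open import Data.Fin.Properties using (suc-injective; 0≢1+n)
open import Data.List using (List; []; _∷_; _++_)
open import Data.List.Relation.Unary.All using (All; []; _∷_)
open import Data.List.Relation.Unary.All.Properties using (++⁺)
open import Data.Product using (_×_; _,_; uncurry)
open import Data.Sum using (inj₁; inj₂)
open import Data.Unit using (tt)
open import Data.Vec using (Vec; []; _∷_; lookup; zip; toList; map)
open import Data.Vec.Properties using (map-cong)
open import Data.Vec.Functional using (updateAt)
open import Data.Vec.Functional.Properties using (updateAt-updates; updateAt-minimal)
open import Function using (const; _∘_; _⇔_; mk⇔; Equivalence)
open import Function.Construct.Identity using (⇔-id)
open import Function.Construct.Composition using (_⇔-∘_)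
open import Relation.Nullary using (yes; no)
open import Relation.Binary.PropositionalEquality

map-cong-lookup : ∀ {A B C : Set} {n} {f : A → C} {g : B → C}
  (xs : Vec A n) (ys : Vec B n) →
  (∀ i → f (lookup xs i) ≡ g (lookup ys i)) → map f xs ≡ map g ys
map-cong-lookup []       []       eq = refl
map-cong-lookup (x ∷ xs) (y ∷ ys) eq = cong₂ _∷_ (eq zero) (map-cong-lookup xs ys (eq ∘ suc))

module _ (nr : ℕ) (δ : Fin nr → ℕ) (nv : ℕ) where
  open Language nr δ nv
  open Structure

  PairwiseDistinct-tail : ∀ {n} {x} {xs : Vec Var n} →
    PairwiseDistinct (x ∷ xs) → PairwiseDistinct xs
  PairwiseDistinct-tail distinct i j eq = suc-injective (distinct (suc i) (suc j) eq)

  Avoids-sym : ∀ {n k} (zs : Vec Var n) (ws : Vec Var k) → Avoids zs ws → Avoids ws zs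
  Avoids-sym zs ws avoids j i eq = avoids i j (sym eq)

  Avoids-tails : ∀ {n k} {z w} {zs : Vec Var n} {ws : Vec Var k} →
    Avoids (z ∷ zs) (w ∷ ws) → Avoids zs ws
  Avoids-tails avoids i j = avoids (suc i) (suc j)

  Avoids⇒zip-distinct : ∀ {n} (as bs : Vec Var n) → Avoids as bs →
    All (uncurry _≢_) (toList (zip as bs))
  Avoids⇒zip-distinct []       []       _      = []
  Avoids⇒zip-distinct (a ∷ as) (b ∷ bs) avoids =
    avoids zero zero ∷ Avoids⇒zip-distinct as bs (Avoids-tails avoids)

  module _ {M : Structure} where

    _[_≔_] : Assignment M → Var → Carrier M → Assignment M
    v [ x ≔ a ] = updateAt v x (const a)

    ⟦⟧-cong : ∀ φ {v w : Assignment M} → v ≗ w → ⟦ φ ⟧ M v → ⟦ φ ⟧ M w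
    ⟦⟧-cong 𝟙          v≗w _            = tt
    ⟦⟧-cong (rel r xs) v≗w holds        = subst (interp M r) (map-cong v≗w xs) holds
    ⟦⟧-cong (x ≈ᶠ y)   v≗w eq           = trans (sym (v≗w x)) (trans eq (v≗w y))
    ⟦⟧-cong (¬ᶠ φ)     v≗w ¬holds holds = ¬holds (⟦⟧-cong φ (sym ∘ v≗w) holds)
    ⟦⟧-cong (φ ∧ᶠ ψ)   v≗w (p , q)      = ⟦⟧-cong φ v≗w p , ⟦⟧-cong ψ v≗w q
    ⟦⟧-cong (φ ∨ᶠ ψ)   v≗w (inj₁ p)     = inj₁ (⟦⟧-cong φ v≗w p)
    ⟦⟧-cong (φ ∨ᶠ ψ)   v≗w (inj₂ q)     = inj₂ (⟦⟧-cong ψ v≗w q)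
    ⟦⟧-cong (∃ᶠ x φ)   v≗w (u , p , agree) = u , p , λ y y≢x → trans (agree y y≢x) (v≗w y)

    ⟦[/]⟧ : ∀ φ {x y} → x ≢ y → (v : Assignment M) →
      ⟦ φ [ x / y ] ⟧ M v ⇔ ⟦ φ ⟧ M (v [ x ≔ v y ])
    ⟦[/]⟧ φ {x} {y} x≢y v = mk⇔ to from
      where
        y≢x : y ≢ x
        y≢x = x≢y ∘ sym

        to : ⟦ φ [ x / y ] ⟧ M v → ⟦ φ ⟧ M (v [ x ≔ v y ])
        to (u , (holds , ux≡uy) , agree) = ⟦⟧-cong φ u≗v[x≔vy] holds
          where
            u≗v[x≔vy] : u ≗ v [ x ≔ v y ]
            u≗v[x≔vy] t with t ≟ x
            ... | yes refl = trans (trans ux≡uy (agree y y≢x)) (sym (updateAt-updates x v))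
            ... | no t≢x   = trans (agree t t≢x) (sym (updateAt-minimal t x v t≢x))

        from : ⟦ φ ⟧ M (v [ x ≔ v y ]) → ⟦ φ [ x / y ] ⟧ M v
        from holds = v [ x ≔ v y ]
                   , (holds , trans (updateAt-updates x v) (sym (updateAt-minimal y x v y≢x)))
                   , λ t t≢x → updateAt-minimal t x v t≢x

    substitute : List (Var × Var) → Assignment M → Assignment M
    substitute []             v = v
    substitute ((x , y) ∷ ps) v = substitute ps v [ x ≔ substitute ps v y ]

    ⟦substs⟧ : ∀ φ ps → All (uncurry _≢_) ps → (v : Assignment M) →
      ⟦ substs φ ps ⟧ M v ⇔ ⟦ φ ⟧ M (substitute ps v)
    ⟦substs⟧ φ []             []            v = ⇔-id _
    ⟦substs⟧ φ ((x , y) ∷ ps) (x≢y ∷ ≢-ps) v =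
      ⟦[/]⟧ φ x≢y (substitute ps v) ⇔-∘ ⟦substs⟧ (φ [ x / y ]) ps ≢-ps v

    substitute-++ : ∀ ps qs (v : Assignment M) →
      substitute (ps ++ qs) v ≡ substitute ps (substitute qs v)
    substitute-++ []             qs v = refl
    substitute-++ ((x , y) ∷ ps) qs v =
      cong (λ w → w [ x ≔ w y ]) (substitute-++ ps qs v)

    substitute-zip-fresh : ∀ {n} (as bs : Vec Var n) (w : Assignment M) {t} →
      (∀ i → lookup as i ≢ t) → substitute (toList (zip as bs)) w t ≡ w t
    substitute-zip-fresh []       []       w fresh = refl
    substitute-zip-fresh (a ∷ as) (b ∷ bs) w fresh =
      trans (updateAt-minimal _ a _ (fresh zero ∘ sym))
            (substitute-zip-fresh as bs w (fresh ∘ suc))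

    substitute-zip-lookup : ∀ {n} (as bs : Vec Var n) (w : Assignment M) →
      PairwiseDistinct as → Avoids as bs →
      ∀ i → substitute (toList (zip as bs)) w (lookup as i) ≡ w (lookup bs i)
    substitute-zip-lookup (a ∷ as) (b ∷ bs) w distinct avoids zero =
      trans (updateAt-updates a _)
            (substitute-zip-fresh as bs w (λ i → avoids (suc i) zero))
    substitute-zip-lookup (a ∷ as) (b ∷ bs) w distinct avoids (suc i) =
      trans (updateAt-minimal _ a _ (0≢1+n ∘ sym ∘ distinct (suc i) zero))
            (substitute-zip-lookup as bs w (PairwiseDistinct-tail distinct)
                                           (Avoids-tails avoids) i)

    ⟦relSubst⟧ : ∀ r (xs ys zs : Vec Var (δ r)) →
      PairwiseDistinct xs → PairwiseDistinct zs → Avoids zs xs → Avoids zs ys →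
      (v : Assignment M) → ⟦ relSubst r xs ys zs ⟧ M v ⇔ ⟦ rel r ys ⟧ M v
    ⟦relSubst⟧ r xs ys zs xs-distinct zs-distinct zs-avoid-xs zs-avoid-ys v =
      subst (λ as → ⟦ relSubst r xs ys zs ⟧ M v ⇔ interp M r as) xs↦ys
            (⟦substs⟧ (rel r xs) (into ++ out) distinct-pairs v)
      where
        into = toList (zip xs zs)
        out  = toList (zip zs ys)

        distinct-pairs : All (uncurry _≢_) (into ++ out)
        distinct-pairs = ++⁺ (Avoids⇒zip-distinct xs zs (Avoids-sym zs xs zs-avoid-xs))
                             (Avoids⇒zip-distinct zs ys zs-avoid-ys)

        xs↦ys : map (substitute (into ++ out) v) xs ≡ map v ys
        xs↦ys = map-cong-lookup xs ys λ i → begin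
          substitute (into ++ out) v (lookup xs i)
            ≡⟨ cong (λ w → w (lookup xs i)) (substitute-++ into out v) ⟩
          substitute into (substitute out v) (lookup xs i)
            ≡⟨ substitute-zip-lookup xs zs _ xs-distinct (Avoids-sym zs xs zs-avoid-xs) i ⟩
          substitute out v (lookup zs i)
            ≡⟨ substitute-zip-lookup zs ys v zs-distinct zs-avoid-ys i ⟩
          v (lookup ys i) ∎
          where open ≡-Reasoning

lemma4p3 : (nr : ℕ) (δ : Fin nr → ℕ) (nv : ℕ) →
    let open Language nr δ nv in
    (r : Fin nr) (xs ys zs : Vec Var (δ r)) →
    PairwiseDistinct xs →
    PairwiseDistinct zs → Avoids zs xs → Avoids zs ys →
    SemEquiv (relSubst r xs ys zs) (rel r ys)
lemma4p3 nr δ nv r xs ys zs xs-distinct zs-distinct zs-avoid-xs zs-avoid-ys M v =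
  to , from
  where
    open Equivalence
      (⟦relSubst⟧ nr δ nv r xs ys zs xs-distinct zs-distinct zs-avoid-xs zs-avoid-ys v)
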